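{- Let $S=\{R_0,\ldots,R_d\}$ be a quasi-thin association scheme on a nonempty finite set $X$, and let $n$ be the number of triples $(u,v,w)\in\{0,\ldots,d\}^3$ with $p_{uv}^w\neq0$. Then $n=(d+1)^2+\bigl|\{(a,b)\in\{0,\ldots,d\}^2: |R_{a'}R_b|=2\}\bigr|$.
   Context: An association scheme on $X$ is a partition $S=\{R_0,\ldots,R_d\}$ of $X\times X$ into nonempty relations with $R_0$ the diagonal, closed under transposes ($R_{c'}$ the transpose of $R_c$), with intersection numbers $p_{ij}^k=|\{\ell:(m,\ell)\in R_i,(\ell,n)\in R_j\}|$ independent of $(m,n)\in R_k$. Valency $k_a=p_{aa'}^0$; quasi-thin: all $k_a\le 2$. Complex product $R_aR_b=\{R_c: p_{ab}^c>0\}$. -}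

module Defs where

open import Data.Nat using (ℕ; suc; _≤_)
import Agda.Primitive
open import Data.Fin using (Fin; zero)
open import Data.Fin.Properties using (_≟_)
open import Data.List using (List; length; filter; allFin; cartesianProduct)
open import Data.Product using (_×_; _,_; proj₁; proj₂)
open import Relation.Binary.PropositionalEquality using (_≡_)
open import Relation.Nullary using (¬_; Dec)
open import Relation.Unary using (Pred; Decidable)
open import Relation.Nullary using (¬?)
import Data.Nat.Properties as ℕP

countFin : ∀ {n} {P : Pred (Fin n) Agda.Primitive.lzero} → Decidable P → ℕ
countFin {n} P? = length (filter P? (allFin n))

interCount : ∀ {N d} → (Fin N → Fin N → Fin (suc d)) →
             Fin N → Fin N → Fin (suc d) → Fin (suc d) → ℕ
interCount rel m n i j = countFin (λ ℓ → decAnd (rel m ℓ ≟ i) (rel ℓ n ≟ j))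
  where
  open import Relation.Nullary.Decidable using (_×-dec_)
  decAnd = _×-dec_

-- An association scheme on X = Fin N with relations R_0,…,R_d.
-- rel x y = c  means (x,y) ∈ R_c  (so {R_c} is a partition of X×X).
record AssocScheme (N d : ℕ) : Set where
  field
    rel      : Fin N → Fin N → Fin (suc d)
    -- every relation is nonempty: a chosen pair in R_c
    wit      : Fin (suc d) → Fin N × Fin N
    wit-ok   : ∀ c → rel (proj₁ (wit c)) (proj₂ (wit c)) ≡ c
    diag⇒    : ∀ x y → rel x y ≡ zero → x ≡ y
    ⇒diag    : ∀ x → rel x x ≡ zero
    -- closed under transposes: R_{c'} is the transpose of R_c
    tr       : Fin (suc d) → Fin (suc d)
    tr-ok    : ∀ x y → rel y x ≡ tr (rel x y)
    -- intersection numbers are well defined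
    regular  : ∀ m n m′ n′ → rel m n ≡ rel m′ n′ →
               ∀ i j → interCount rel m n i j ≡ interCount rel m′ n′ i j

  p : Fin (suc d) → Fin (suc d) → Fin (suc d) → ℕ
  p i j k = interCount rel (proj₁ (wit k)) (proj₂ (wit k)) i j

  valency : Fin (suc d) → ℕ
  valency a = p a (tr a) zero

  -- |R_a R_b| = number of c with p_{ab}^c > 0
  complexSize : Fin (suc d) → Fin (suc d) → ℕ
  complexSize a b = countFin (λ c → ¬? (p a b c ℕP.≟ 0))

  nonzeroTriples : ℕ
  nonzeroTriples =
    length (filter (λ t → ¬? (p (proj₁ t) (proj₁ (proj₂ t)) (proj₂ (proj₂ t)) ℕP.≟ 0))
                   (cartesianProduct (allFin (suc d))
                     (cartesianProduct (allFin (suc d)) (allFin (suc d)))))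

  pairsSize2 : ℕ
  pairsSize2 =
    length (filter (λ t → complexSize (tr (proj₁ t)) (proj₂ t) ℕP.≟ 2)
                   (cartesianProduct (allFin (suc d)) (allFin (suc d))))

QuasiThin : ∀ {N d} → AssocScheme N d → Set
QuasiThin S = ∀ a → AssocScheme.valency S a ≤ 2

-- Every complex product R_a R_b is nonempty, and it has at most k_{a'} elements: fixing
-- (y,z) ∈ R_b, each R_c ∈ R_a R_b contains (x,z) for some x with (y,x) ∈ R_{a'}.  In a
-- quasi-thin scheme |R_a R_b| is therefore 1 or 2, so summing |R_a R_b| = |{c : p_{ab}^c ≠ 0}|
-- over all (a,b) gives (d+1)² plus the number of pairs with |R_a R_b| = 2; replacing a by a'
-- is a bijection of the index set.
module Submission where

open import Defs
open import Data.Nat using (ℕ; zero; suc; _+_; _*_; _^_; _≤_; _<_; z≤n; s≤s)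
import Data.Nat.Properties as ℕ
open import Data.Bool using (if_then_else_)
open import Data.Fin using (Fin; zero; suc)
open import Data.Fin.Properties using (_≟_)
open import Data.Fin.Permutation using (Permutation′; permutation)
open import Data.List using (List; []; _∷_; length; filter; tabulate; allFin; cartesianProduct; map; _++_)
open import Data.List.Properties using (length-++; filter-++; filter-some; filter-≐)
open import Data.List.Membership.Propositional using (lose)
open import Data.List.Membership.Propositional.Properties using (∈-allFin)
open import Data.Product using (∃; _×_; _,_; proj₁; proj₂)
open import Function using (_∘_; id)
open import Level using (0ℓ)
open import Relation.Binary.PropositionalEquality
  using (_≡_; _≢_; refl; sym; trans; cong; cong₂; subst; module ≡-Reasoning)
open import Relation.Nullary using (Dec; does; yes; no; ¬?; contradiction)
open import Relation.Nullary.Decidable using (_×-dec_)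
open import Relation.Unary using (Pred; Decidable)
open import Algebra.Properties.Semiring.Sum ℕ.+-*-semiring
  using (sum; sum-cong-≗; sum-remove; sum-permute; ∑-comm; ∑-distrib-+; *-distribˡ-sum)

private
  variable
    A B : Set
    m n : ℕ

indicator : {P : Set} → Dec P → ℕ
indicator P? = if does P? then 1 else 0

indicator-mono : {P Q : Set} (P? : Dec P) (Q? : Dec Q) → (P → Q) → indicator P? ≤ indicator Q?
indicator-mono (yes p) (yes _) _   = ℕ.≤-refl
indicator-mono (yes p) (no ¬q) P→Q = contradiction (P→Q p) ¬q
indicator-mono (no _)  _       _   = z≤n

indicator-× : {P Q : Set} (P? : Dec P) (Q? : Dec Q) →
              indicator (P? ×-dec Q?) ≡ indicator P? * indicator Q?
indicator-× (yes _) (yes _) = refl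
indicator-× (yes _) (no _)  = refl
indicator-× (no _)  _       = refl

sum-mono-≤ : {f g : Fin n → ℕ} → (∀ i → f i ≤ g i) → sum f ≤ sum g
sum-mono-≤ {zero}  _   = z≤n
sum-mono-≤ {suc n} f≤g = ℕ.+-mono-≤ (f≤g zero) (sum-mono-≤ (f≤g ∘ suc))

≤-sum : (f : Fin n → ℕ) (i : Fin n) → f i ≤ sum f
≤-sum {suc n} f i = ℕ.≤-trans (ℕ.m≤m+n (f i) _) (ℕ.≤-reflexive (sym (sum-remove {i = i} f)))

sum-const : ∀ n c → sum {n} (λ _ → c) ≡ n * c
sum-const zero    c = refl
sum-const (suc n) c = cong (c +_) (sum-const n c)

∑-indicator-≟ : (i : Fin n) → sum (λ j → indicator (i ≟ j)) ≡ 1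
∑-indicator-≟ {suc n} zero    = cong suc (trans (sum-const n 0) (ℕ.*-zeroʳ n))
∑-indicator-≟ {suc n} (suc i) = ∑-indicator-≟ i

∑∑-1+ : (f : Fin n → Fin n → ℕ) →
        sum (λ u → sum (λ v → 1 + f u v)) ≡ n ^ 2 + sum (λ u → sum (f u))
∑∑-1+ {n} f = begin
  sum (λ u → sum (λ v → 1 + f u v))                    ≡⟨ sum-cong-≗ (λ u → ∑-distrib-+ (λ _ → 1) (f u)) ⟩
  sum (λ u → sum {n} (λ _ → 1) + sum (f u))            ≡⟨ ∑-distrib-+ (λ _ → sum {n} (λ _ → 1)) (sum ∘ f) ⟩
  sum {n} (λ _ → sum {n} (λ _ → 1)) + sum (sum ∘ f)    ≡⟨ cong (_+ sum (sum ∘ f)) n*n≡n^2 ⟩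
  n ^ 2 + sum (sum ∘ f)                                ∎
  where
  open ≡-Reasoning
  n*n≡n^2 : sum {n} (λ _ → sum {n} (λ _ → 1)) ≡ n ^ 2
  n*n≡n^2 = trans (sum-const n _) (cong (n *_) (sum-const n 1))

one-or-two : ∀ {k} → 1 ≤ k → k ≤ 2 → k ≡ 1 + indicator (k ℕ.≟ 2)
one-or-two {1} _ _ = refl
one-or-two {2} _ _ = refl
one-or-two {suc (suc (suc _))} _ (s≤s (s≤s ()))

length-filter-tabulate : {P : Pred A 0ℓ} (P? : Decidable P) (f : Fin n → A) →
                         length (filter P? (tabulate f)) ≡ sum (λ i → indicator (P? (f i)))
length-filter-tabulate {n = zero}  P? f = refl
length-filter-tabulate {n = suc n} P? f with P? (f zero)
... | yes _ = cong suc (length-filter-tabulate P? (f ∘ suc))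
... | no  _ = length-filter-tabulate P? (f ∘ suc)

length-filter-map : {P : Pred B 0ℓ} (P? : Decidable P) (h : A → B) (xs : List A) →
                    length (filter P? (map h xs)) ≡ length (filter (P? ∘ h) xs)
length-filter-map P? h []       = refl
length-filter-map P? h (x ∷ xs) with P? (h x)
... | yes _ = cong suc (length-filter-map P? h xs)
... | no  _ = length-filter-map P? h xs

length-filter-cartesianProduct :
  {P : Pred (A × B) 0ℓ} (P? : Decidable P) (f : Fin n → A) (ys : List B) →
  length (filter P? (cartesianProduct (tabulate f) ys)) ≡
    sum (λ i → length (filter (λ y → P? (f i , y)) ys))
length-filter-cartesianProduct {n = zero}  P? f ys = refl
length-filter-cartesianProduct {n = suc n} P? f ys = begin
  length (filter P? (row ++ rest))                  ≡⟨ cong length (filter-++ P? row rest) ⟩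
  length (filter P? row ++ filter P? rest)          ≡⟨ length-++ (filter P? row) ⟩
  length (filter P? row) + length (filter P? rest)  ≡⟨ cong₂ _+_ (length-filter-map P? (f zero ,_) ys)
                                                                 (length-filter-cartesianProduct P? (f ∘ suc) ys) ⟩
  _                                                 ∎
  where
  open ≡-Reasoning
  row  = map (f zero ,_) ys
  rest = cartesianProduct (tabulate (f ∘ suc)) ys

countFin≡∑indicator : {P : Pred (Fin n) 0ℓ} (P? : Decidable P) →
                      countFin P? ≡ sum (λ i → indicator (P? i))
countFin≡∑indicator P? = length-filter-tabulate P? id

countFin-pos : {P : Pred (Fin n) 0ℓ} (P? : Decidable P) {x : Fin n} → P x → 0 < countFin P?
countFin-pos P? {x} px = filter-some P? (lose (∈-allFin x) px)

0<length-filter⇒∃ : {P : Pred A 0ℓ} (P? : Decidable P) (xs : List A) →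
                    0 < length (filter P? xs) → ∃ P
0<length-filter⇒∃ P? (x ∷ xs) 0<len with P? x
... | yes px = x , px
... | no  _  = 0<length-filter⇒∃ P? xs 0<len

-- Double counting of the pairs (x , c) with Q x and h x ≡ c.
countFin-≤-image : {P : Pred (Fin m) 0ℓ} {Q : Pred (Fin n) 0ℓ}
                   (P? : Decidable P) (Q? : Decidable Q) (h : Fin n → Fin m) →
                   (∀ c → P c → ∃ λ x → Q x × h x ≡ c) → countFin P? ≤ countFin Q?
countFin-≤-image {m} {n} P? Q? h onto = begin
  countFin P?                           ≡⟨ countFin≡∑indicator P? ⟩
  sum (λ c → indicator (P? c))          ≤⟨ sum-mono-≤ fibre-nonempty ⟩
  sum (λ c → sum (λ x → [Q∧h≡] x c))    ≡⟨ ∑-comm [Q∧h≡] ⟨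
  sum (λ x → sum (λ c → [Q∧h≡] x c))    ≡⟨ sum-cong-≗ fibre-sum ⟩
  sum (λ x → indicator (Q? x))          ≡⟨ countFin≡∑indicator Q? ⟨
  countFin Q?                           ∎
  where
  open ℕ.≤-Reasoning
  [Q∧h≡] : Fin n → Fin m → ℕ
  [Q∧h≡] x c = indicator (Q? x ×-dec (h x ≟ c))

  fibre-nonempty : ∀ c → indicator (P? c) ≤ sum (λ x → [Q∧h≡] x c)
  fibre-nonempty c with P? c
  ... | no  _  = z≤n
  ... | yes pc with onto c pc
  ...   | x , qx , hx≡c =
    ℕ.≤-trans (indicator-mono (yes pc) (Q? x ×-dec (h x ≟ c)) (λ _ → qx , hx≡c))
              (≤-sum (λ x → [Q∧h≡] x c) x)

  fibre-sum : ∀ x → sum ([Q∧h≡] x) ≡ indicator (Q? x)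
  fibre-sum x = begin-equality
    sum (λ c → indicator (Q? x ×-dec (h x ≟ c)))         ≡⟨ sum-cong-≗ (λ c → indicator-× (Q? x) (h x ≟ c)) ⟩
    sum (λ c → indicator (Q? x) * indicator (h x ≟ c))   ≡⟨ *-distribˡ-sum (indicator (Q? x)) (indicator ∘ (h x ≟_)) ⟨
    indicator (Q? x) * sum (λ c → indicator (h x ≟ c))   ≡⟨ cong (indicator (Q? x) *_) (∑-indicator-≟ (h x)) ⟩
    indicator (Q? x) * 1                                 ≡⟨ ℕ.*-identityʳ _ ⟩
    indicator (Q? x)                                     ∎

module SchemeProperties {N d : ℕ} (S : AssocScheme N d) where
  open AssocScheme S

  tr-involutive : ∀ a → tr (tr a) ≡ a
  tr-involutive a = begin
    tr (tr a)          ≡⟨ cong (tr ∘ tr) (wit-ok a) ⟨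
    tr (tr (rel x y))  ≡⟨ cong tr (tr-ok x y) ⟨
    tr (rel y x)       ≡⟨ tr-ok y x ⟨
    rel x y            ≡⟨ wit-ok a ⟩
    a                  ∎
    where
    open ≡-Reasoning
    x = proj₁ (wit a)
    y = proj₂ (wit a)

  tr-permutation : Permutation′ (suc d)
  tr-permutation = permutation tr tr tr-involutive tr-involutive

  outDegree : Fin N → Fin (suc d) → ℕ
  outDegree x i = countFin (λ ℓ → rel x ℓ ≟ i)

  interCount-back : ∀ x i → interCount rel x x i (tr i) ≡ outDegree x i
  interCount-back x i = cong length (filter-≐ _ _ (proj₁ , back) (allFin N))
    where
    back : ∀ {ℓ} → rel x ℓ ≡ i → rel x ℓ ≡ i × rel ℓ x ≡ tr i
    back {ℓ} xℓ≡i = xℓ≡i , trans (tr-ok x ℓ) (cong tr xℓ≡i)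

  valency≡outDegree : ∀ a x → valency a ≡ outDegree x a
  valency≡outDegree a x =
    trans (regular _ _ x x (trans (wit-ok zero) (sym (⇒diag x))) a (tr a)) (interCount-back x a)

  successor : ∀ x b → ∃ λ z → rel x z ≡ b
  successor x b = 0<length-filter⇒∃ (λ z → rel x z ≟ b) (allFin N) 0<outDegree
    where
    y = proj₁ (wit b)
    0<outDegree : 0 < outDegree x b
    0<outDegree = subst (0 <_) (trans (sym (valency≡outDegree b y)) (valency≡outDegree b x))
                        (countFin-pos (λ z → rel y z ≟ b) (wit-ok b))

  interCount≡p : ∀ x z a b → interCount rel x z a b ≡ p a b (rel x z)
  interCount≡p x z a b = regular x z _ _ (sym (wit-ok (rel x z))) a b

  path⇒p≢0 : ∀ {x ℓ z a b} → rel x ℓ ≡ a → rel ℓ z ≡ b → p a b (rel x z) ≢ 0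
  path⇒p≢0 {x} {ℓ} {z} {a} {b} xℓ≡a ℓz≡b = ℕ.n>0⇒n≢0
    (subst (0 <_) (interCount≡p x z a b)
           (countFin-pos (λ ℓ → (rel x ℓ ≟ a) ×-dec (rel ℓ z ≟ b)) (xℓ≡a , ℓz≡b)))

  p≢0⇒path : ∀ {x z} a b → p a b (rel x z) ≢ 0 → ∃ λ ℓ → rel x ℓ ≡ a × rel ℓ z ≡ b
  p≢0⇒path {x} {z} a b p≢0 =
    0<length-filter⇒∃ (λ ℓ → (rel x ℓ ≟ a) ×-dec (rel ℓ z ≟ b)) (allFin N)
      (subst (0 <_) (sym (interCount≡p x z a b)) (ℕ.n≢0⇒n>0 p≢0))

  complexSize-pos : ∀ a b → 1 ≤ complexSize a b
  complexSize-pos a b with successor (proj₂ (wit a)) b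
  ... | z , yz≡b = countFin-pos (λ c → ¬? (p a b c ℕ.≟ 0)) (path⇒p≢0 (wit-ok a) yz≡b)

  complexSize≤valency : ∀ a b → complexSize a b ≤ valency (tr a)
  complexSize≤valency a b = ℕ.≤-trans
    (countFin-≤-image (λ c → ¬? (p a b c ℕ.≟ 0)) (λ x → rel y x ≟ tr a) (λ x → rel x z) onto)
    (ℕ.≤-reflexive (sym (valency≡outDegree (tr a) y)))
    where
    y = proj₁ (wit b)
    z = proj₂ (wit b)
    onto : ∀ c → p a b c ≢ 0 → ∃ λ x → rel y x ≡ tr a × rel x z ≡ c
    onto c pabc≢0 with p≢0⇒path a b (subst (λ k → p a b k ≢ 0) (sym (wit-ok c)) pabc≢0)
    ... | ℓ , xℓ≡a , ℓz≡b =
      p≢0⇒path (tr a) c (subst (λ k → p (tr a) c k ≢ 0) (trans ℓz≡b (sym (wit-ok b)))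
                                (path⇒p≢0 (trans (tr-ok _ ℓ) (cong tr xℓ≡a)) (wit-ok c)))

  complexSize≡1+[≡2] : QuasiThin S → ∀ a b → complexSize a b ≡ 1 + indicator (complexSize a b ℕ.≟ 2)
  complexSize≡1+[≡2] quasiThin a b =
    one-or-two (complexSize-pos a b) (ℕ.≤-trans (complexSize≤valency a b) (quasiThin (tr a)))

  nonzeroTriples≡∑∑complexSize : nonzeroTriples ≡ sum (λ a → sum (λ b → complexSize a b))
  nonzeroTriples≡∑∑complexSize =
    trans (length-filter-cartesianProduct (λ (a , b , c) → nonzero a b c) id
             (cartesianProduct (allFin (suc d)) (allFin (suc d))))
          (sum-cong-≗ (λ a → length-filter-cartesianProduct (λ (b , c) → nonzero a b c) id (allFin (suc d))))
    where
    nonzero : ∀ a b c → Dec (p a b c ≢ 0)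
    nonzero a b c = ¬? (p a b c ℕ.≟ 0)

  pairsSize2≡∑∑ : pairsSize2 ≡ sum (λ a → sum (λ b → indicator (complexSize (tr a) b ℕ.≟ 2)))
  pairsSize2≡∑∑ =
    trans (length-filter-cartesianProduct (λ (a , b) → complexSize (tr a) b ℕ.≟ 2) id (allFin (suc d)))
          (sum-cong-≗ (λ a → length-filter-tabulate (λ b → complexSize (tr a) b ℕ.≟ 2) id))

lemma2p2 : ∀ {m d : ℕ} (S : AssocScheme (suc m) d) → QuasiThin S →
    AssocScheme.nonzeroTriples S ≡ (suc d) ^ 2 + AssocScheme.pairsSize2 S
lemma2p2 {d = d} S quasiThin = begin
  nonzeroTriples                                ≡⟨ nonzeroTriples≡∑∑complexSize ⟩
  sum (λ a → sum (λ b → complexSize a b))       ≡⟨ sum-cong-≗ (sum-cong-≗ ∘ complexSize≡1+[≡2] quasiThin) ⟩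
  sum (λ a → sum (λ b → 1 + size2 a b))         ≡⟨ ∑∑-1+ size2 ⟩
  suc d ^ 2 + sum (λ a → sum (size2 a))         ≡⟨ cong (suc d ^ 2 +_) (sum-permute (sum ∘ size2) tr-permutation) ⟩
  suc d ^ 2 + sum (λ a → sum (size2 (tr a)))    ≡⟨ cong (suc d ^ 2 +_) pairsSize2≡∑∑ ⟨
  suc d ^ 2 + pairsSize2                        ∎
  where
  open AssocScheme S
  open SchemeProperties S
  open ≡-Reasoning
  size2 : Fin (suc d) → Fin (suc d) → ℕ
  size2 a b = indicator (complexSize a b ℕ.≟ 2)
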